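{- Let $\mathbf{a}=(a_1,\ldots,a_k)$ be an integer partition and $n=a_1+\cdots+a_k$. The graph $G(\mathbf{a})$ is $k$-partite with partition classes $\Pi(\mathbf{a})^{1,1},\ldots,\Pi(\mathbf{a})^{1,k}$, and $$s_i:=|\Pi(\mathbf{a})^{1,i}|=\frac{(n-1)!}{a_1!\cdots a_{i-1}!\,(a_i-1)!\,a_{i+1}!\cdots a_k!}.$$ Moreover $s_1\geq s_2\geq\cdots\geq s_k$. Finally, if $\Delta(\mathbf{a})<0$ then $s_1>\sum_{i=2}^k s_i$; if $\Delta(\mathbf{a})=0$ then $s_1=\sum_{i=2}^k s_i$; and if $\Delta(\mathbf{a})>0$ then every partition class is smaller than the union of all other classes, i.e., $s_j<\sum_{i\neq j}s_i$ for every $j$.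
   Context: An integer partition is $\mathbf{a}=(a_1,\ldots,a_k)$ with $k\geq 2$ and $a_1\geq\cdots\geq a_k\geq 1$. $\Pi(\mathbf{a})$ is the set of strings of length $n$ over $\{1,\ldots,k\}$ containing exactly $a_i$ occurrences of symbol $i$; $\Pi(\mathbf{a})^{1,c}$ is the set of those whose first symbol is $c$. $G(\mathbf{a})$ is the graph on $\Pi(\mathbf{a})$ where two strings are adjacent if one arises from the other by swapping the first entry with an entry at some position $2,\ldots,n$ distinct from the first entry. $\Delta(\mathbf{a}):=n-2a_1$. -}

module Defs where

open import Data.Nat using (ℕ; zero; suc; _+_; _*_; _∸_; _≤_; _<_)
open import Data.Nat using (_!)
open import Data.Fin using (Fin) renaming (_≤_ to _≤ᶠ_)
open import Data.Fin.Properties using (all?) renaming (_≟_ to _≟ᶠ_)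
open import Data.Vec using (Vec; []; _∷_; lookup; count; _[_]≔_)
open import Data.List using (List; []; _∷_; concatMap; map; filter; length; allFin)
open import Data.Nat.ListAction using (sum; product)
open import Data.Product using (Σ; ∃; _×_; _,_)
open import Relation.Nullary using (¬_; Dec; ¬?)
open import Relation.Nullary.Decidable using (_×-dec_)
open import Relation.Binary.PropositionalEquality using (_≡_; _≢_)
open import Data.Nat.Properties using () renaming (_≟_ to _≟ℕ_)

-- An integer partition a = (a_1,...,a_k) with k = 2 + m ≥ 2, indexed by Fin k
-- (index zero corresponds to a_1).  Nonincreasing and all parts ≥ 1.
IsPartition : {k : ℕ} → (Fin k → ℕ) → Set
IsPartition {k} a = (∀ i j → i ≤ᶠ j → a j ≤ a i) × (∀ i → 1 ≤ a i)

total : {k : ℕ} → (Fin k → ℕ) → ℕ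
total {k} a = sum (map a (allFin k))

InΠ : {k n : ℕ} → (Fin k → ℕ) → Vec (Fin k) n → Set
InΠ a v = ∀ i → count (_≟ᶠ i) v ≡ a i

InΠ? : {k n : ℕ} → (a : Fin k → ℕ) → (v : Vec (Fin k) n) → Dec (InΠ a v)
InΠ? a v = all? (λ i → count (_≟ᶠ i) v ≟ℕ a i)

First : {k n : ℕ} → Vec (Fin k) n → Fin k → Set
First [] c = Data.Empty.⊥ where import Data.Empty
First (h ∷ _) c = h ≡ c

First? : {k n : ℕ} → (v : Vec (Fin k) n) → (c : Fin k) → Dec (First v c)
First? [] c = Relation.Nullary.no (λ ())
First? (h ∷ _) c = h ≟ᶠ c

InΠ1 : {k n : ℕ} → (Fin k → ℕ) → Fin k → Vec (Fin k) n → Set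
InΠ1 a c v = InΠ a v × First v c

-- adjacency in G(a): y arises from x by swapping the first entry with an entry
-- at some later position j whose symbol differs from the first entry
Adj : {k n : ℕ} → Vec (Fin k) n → Vec (Fin k) n → Set
Adj [] [] = Data.Empty.⊥ where import Data.Empty
Adj {n = suc m} (h ∷ t) (h' ∷ t') =
  Σ (Fin m) λ j → (lookup t j ≢ h) × (h' ≡ lookup t j) × (t' ≡ t [ j ]≔ h)

allVecs : (k n : ℕ) → List (Vec (Fin k) n)
allVecs k zero = [] ∷ []
allVecs k (suc n) = concatMap (λ c → map (c ∷_) (allVecs k n)) (allFin k)

s : {k : ℕ} → (Fin k → ℕ) → Fin k → ℕ
s {k} a c = length (filter (λ v → InΠ? a v ×-dec First? v c) (allVecs k (total a)))

sumOthers : {k : ℕ} → (Fin k → ℕ) → Fin k → ℕ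
sumOthers {k} a j = sum (map (s a) (filter (λ i → ¬? (i ≟ᶠ j)) (allFin k)))

denom : {k : ℕ} → (Fin k → ℕ) → Fin k → ℕ
denom {k} a i = product (map (λ j → f j (j ≟ᶠ i)) (allFin k))
  where
  f : (j : Fin k) → Dec (j ≡ i) → ℕ
  f j (Relation.Nullary.yes _) = (a j ∸ 1) !
  f j (Relation.Nullary.no _) = (a j) !

{-# OPTIONS --safe #-}
-- Removing the first symbol c of a string in Π(a) leaves a string of content a − e_c, and
-- splitting by the first symbol gives the multinomial identity |Π_n(a)| · ∏ a_j! = n!.
-- Hence s_c · ∏ a_j! = a_c · (n − 1)!, so the class sizes s_c are proportional to the
-- parts a_c and their sum to n: every comparison between the s_c, or between s_j and the
-- sum of the others, is the same comparison between the a_c, or between a_j and n − a_j.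
module Submission where

open import Defs
open import Algebra.Bundles using (CommutativeMonoid)
import Algebra.Properties.CommutativeMonoid.Sum as MonoidSum
import Algebra.Properties.Semiring.Sum as SemiringSum
open import Data.Bool using (true; false; if_then_else_)
open import Data.Fin using (Fin; zero; suc; punchIn) renaming (_≤_ to _≤ᶠ_)
open import Data.Fin.Properties using (punchInᵢ≢i) renaming (_≟_ to _≟ᶠ_)
open import Data.List as List using (List; []; _∷_; map; filter; length; tabulate; allFin; concatMap)
open import Data.List.Properties using (filter-++; length-++; filter-≐; filter-none; filter-accept; map-cong; map-tabulate)
open import Data.List.Relation.Unary.All using (universal)
open import Data.Nat using (ℕ; zero; suc; _+_; _*_; _∸_; _≤_; _<_; _>_; z≤n; _!; NonZero)
open import Data.Nat.ListAction using (sum; product)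
open import Data.Nat.Properties
open import Algebra.Properties.CommutativeSemigroup *-commutativeSemigroup using (x∙yz≈y∙xz)
open import Data.Product using (∃; _×_; _,_; proj₁; proj₂)
open import Data.Vec using (Vec; []; _∷_)
open import Data.Vec.Functional using (Vector; removeAt)
import Data.Vec.Functional as Vector
open import Function using (id; _∘_)
open import Relation.Nullary using (¬_; Dec; yes; no; does; ¬?; contradiction)
open import Relation.Nullary.Decidable using (_×-dec_; dec-true; dec-false)
open import Relation.Binary.PropositionalEquality using (_≡_; _≢_; refl; sym; trans; cong; cong₂; subst₂; module ≡-Reasoning)
open import Level using (0ℓ)
open import Relation.Unary using (Pred; Decidable)

module _ {c ℓ} (M : CommutativeMonoid c ℓ) where
  open CommutativeMonoid M using (Carrier; _≈_; _∙_; ∙-cong; ∙-congˡ; assoc; setoid)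
    renaming (sym to ≈-sym)
  open MonoidSum M using (sum-remove; sum-cong-≋) renaming (sum to ∑ᴹ)
  open import Relation.Binary.Reasoning.Setoid setoid

  sum-update : ∀ {k} {f g : Vector Carrier k} (i : Fin k) (x : Carrier) →
               (∀ j → j ≢ i → f j ≈ g j) → f i ≈ x ∙ g i → ∑ᴹ f ≈ x ∙ ∑ᴹ g
  sum-update {suc k} {f} {g} i x f≈g fi≈x∙gi = begin
    ∑ᴹ f                           ≈⟨ sum-remove {i = i} f ⟩
    f i ∙ ∑ᴹ (removeAt f i)        ≈⟨ ∙-cong fi≈x∙gi (sum-cong-≋ (λ j → f≈g (punchIn i j) (punchInᵢ≢i i j))) ⟩
    (x ∙ g i) ∙ ∑ᴹ (removeAt g i)  ≈⟨ assoc x (g i) _ ⟩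
    x ∙ (g i ∙ ∑ᴹ (removeAt g i))  ≈⟨ ∙-congˡ (≈-sym (sum-remove {i = i} g)) ⟩
    x ∙ ∑ᴹ g                       ∎

module Sumℕ = SemiringSum +-*-semiring
module Productℕ = MonoidSum *-1-commutativeMonoid

∑ ∏ : ∀ {k} → (Fin k → ℕ) → ℕ
∑ = Sumℕ.sum
∏ = Productℕ.sum

foldr-tabulate : ∀ {A : Set} (_∙_ : A → A → A) (e : A) {k} (f : Fin k → A) →
                 List.foldr _∙_ e (tabulate f) ≡ Vector.foldr _∙_ e f
foldr-tabulate _∙_ e {zero} f = refl
foldr-tabulate _∙_ e {suc k} f = cong (f zero ∙_) (foldr-tabulate _∙_ e (f ∘ suc))

foldr-map-allFin : ∀ {A : Set} (_∙_ : A → A → A) (e : A) {k} (f : Fin k → A) →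
                   List.foldr _∙_ e (map f (allFin k)) ≡ Vector.foldr _∙_ e f
foldr-map-allFin _∙_ e f = trans (cong (List.foldr _∙_ e) (map-tabulate id f)) (foldr-tabulate _∙_ e f)

total≡∑ : ∀ {k} (a : Fin k → ℕ) → total a ≡ ∑ a
total≡∑ = foldr-map-allFin _+_ 0

∑≡0⇒≡0 : ∀ {k} (f : Fin k → ℕ) → ∑ f ≡ 0 → ∀ j → f j ≡ 0
∑≡0⇒≡0 {suc k} f ∑f≡0 j = m+n≡0⇒m≡0 (f j) (trans (sym (Sumℕ.sum-remove {i = j} f)) ∑f≡0)

∑-concentrated : ∀ {k} (f : Fin k → ℕ) (i : Fin k) → (∀ j → j ≢ i → f j ≡ 0) → ∑ f ≡ f i
∑-concentrated {k} f i f≡0 = begin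
  ∑ f                    ≡⟨ sum-update +-0-commutativeMonoid {f = f} {g = λ _ → 0} i (f i) f≡0 (sym (+-identityʳ (f i))) ⟩
  f i + ∑ {k} (λ _ → 0)  ≡⟨ cong (f i +_) (Sumℕ.sum-replicate-zero k) ⟩
  f i + 0                ≡⟨ +-identityʳ (f i) ⟩
  f i                    ∎
  where open ≡-Reasoning

∏-nonZero : ∀ {k} (f : Fin k → ℕ) → (∀ j → NonZero (f j)) → NonZero (∏ f)
∏-nonZero {zero} f _ = _
∏-nonZero {suc k} f f≢0 = m*n≢0 (f zero) (∏ (f ∘ suc)) {{f≢0 zero}} {{∏-nonZero (f ∘ suc) (f≢0 ∘ suc)}}

module _ {A : Set} {P : Pred A 0ℓ} (P? : Decidable P) where

  length-filter-concatMap : ∀ {B : Set} (g : B → List A) (xs : List B) →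
    length (filter P? (concatMap g xs)) ≡ sum (map (length ∘ filter P? ∘ g) xs)
  length-filter-concatMap g [] = refl
  length-filter-concatMap g (x ∷ xs) = begin
    length (filter P? (g x List.++ concatMap g xs))                   ≡⟨ cong length (filter-++ P? (g x) _) ⟩
    length (filter P? (g x) List.++ filter P? (concatMap g xs))       ≡⟨ length-++ (filter P? (g x)) ⟩
    length (filter P? (g x)) + length (filter P? (concatMap g xs))    ≡⟨ cong (_ +_) (length-filter-concatMap g xs) ⟩
    length (filter P? (g x)) + sum (map (length ∘ filter P? ∘ g) xs)  ∎
    where open ≡-Reasoning

  length-filter-map : ∀ {B : Set} (h : B → A) (xs : List B) →
    length (filter P? (map h xs)) ≡ length (filter (P? ∘ h) xs)
  length-filter-map h [] = refl
  length-filter-map h (x ∷ xs) with does (P? (h x))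
  ... | true = cong suc (length-filter-map h xs)
  ... | false = length-filter-map h xs

  sum-map-filter : (f : A → ℕ) (xs : List A) →
    sum (map f (filter P? xs)) ≡ sum (map (λ x → if does (P? x) then f x else 0) xs)
  sum-map-filter f [] = refl
  sum-map-filter f (x ∷ xs) with does (P? x)
  ... | true = cong (f x +_) (sum-map-filter f xs)
  ... | false = sum-map-filter f xs

length-filter-allVecs-suc : ∀ {k n} {P : Pred (Vec (Fin k) (suc n)) 0ℓ} (P? : Decidable P) →
  length (filter P? (allVecs k (suc n))) ≡ ∑ (λ c → length (filter (P? ∘ (c ∷_)) (allVecs k n)))
length-filter-allVecs-suc {k} {n} P? = begin
  length (filter P? (allVecs k (suc n)))
    ≡⟨ length-filter-concatMap P? (λ c → map (c ∷_) (allVecs k n)) (allFin k) ⟩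
  sum (map (λ c → length (filter P? (map (c ∷_) (allVecs k n)))) (allFin k))
    ≡⟨ cong sum (map-cong (λ c → length-filter-map P? (c ∷_) (allVecs k n)) (allFin k)) ⟩
  sum (map (λ c → length (filter (P? ∘ (c ∷_)) (allVecs k n))) (allFin k))
    ≡⟨ foldr-map-allFin _+_ 0 (λ c → length (filter (P? ∘ (c ∷_)) (allVecs k n))) ⟩
  ∑ (λ c → length (filter (P? ∘ (c ∷_)) (allVecs k n)))  ∎
  where open ≡-Reasoning

decrementAt : ∀ {k} → (Fin k → ℕ) → Fin k → Fin k → ℕ
decrementAt a c j = if does (j ≟ᶠ c) then a j ∸ 1 else a j

module _ {k} (a : Fin k → ℕ) {c : Fin k} where

  decrementAt-self : decrementAt a c c ≡ a c ∸ 1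
  decrementAt-self rewrite dec-true (c ≟ᶠ c) refl = refl

  decrementAt-other : ∀ {j} → j ≢ c → decrementAt a c j ≡ a j
  decrementAt-other {j} j≢c rewrite dec-false (j ≟ᶠ c) j≢c = refl

  ∑-decrementAt : 1 ≤ a c → ∑ a ≡ suc (∑ (decrementAt a c))
  ∑-decrementAt 1≤ac = sum-update +-0-commutativeMonoid {f = a} {g = decrementAt a c} c 1
    (λ j j≢c → sym (decrementAt-other j≢c))
    (trans (sym (m+[n∸m]≡n 1≤ac)) (cong suc (sym decrementAt-self)))

  ∏-factorial-decrementAt : 1 ≤ a c → ∏ (λ j → a j !) ≡ a c * ∏ (λ j → decrementAt a c j !)
  ∏-factorial-decrementAt 1≤ac = sum-update *-1-commutativeMonoid
    {f = λ j → a j !} {g = λ j → decrementAt a c j !} c (a c)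
    (λ j j≢c → cong _! (sym (decrementAt-other j≢c)))
    (trans (factorial-pred (a c) 1≤ac) (cong (λ m → a c * m !) (sym decrementAt-self)))
    where
    factorial-pred : ∀ n → 1 ≤ n → n ! ≡ n * (n ∸ 1) !
    factorial-pred (suc n) _ = refl

  module _ {n} {v : Vec (Fin k) n} where

    InΠ-∷⁺ : InΠ a (c ∷ v) → InΠ (decrementAt a c) v
    InΠ-∷⁺ c∷v∈Π i with c ≟ᶠ i | c∷v∈Π i
    ... | yes refl | 1+count≡ac = trans (cong (_∸ 1) 1+count≡ac) (sym decrementAt-self)
    ... | no c≢i   | count≡ai   = trans count≡ai (sym (decrementAt-other (c≢i ∘ sym)))

    InΠ-∷⁻ : 1 ≤ a c → InΠ (decrementAt a c) v → InΠ a (c ∷ v)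
    InΠ-∷⁻ 1≤ac v∈Π i with c ≟ᶠ i | v∈Π i
    ... | yes refl | count≡ac∸1 = trans (cong suc (trans count≡ac∸1 decrementAt-self)) (m+[n∸m]≡n 1≤ac)
    ... | no c≢i   | count≡ai   = trans count≡ai (decrementAt-other (c≢i ∘ sym))

    ¬InΠ-∷ : a c ≡ 0 → ¬ InΠ a (c ∷ v)
    ¬InΠ-∷ ac≡0 c∷v∈Π with c ≟ᶠ c | c∷v∈Π c
    ... | yes _   | 1+count≡ac = 0≢1+n (trans (sym ac≡0) (sym 1+count≡ac))
    ... | no c≢c  | _          = c≢c refl

countΠ : ∀ {k} → ℕ → (Fin k → ℕ) → ℕ
countΠ {k} n a = length (filter (InΠ? a) (allVecs k n))

countΠ∷ : ∀ {k} → ℕ → (Fin k → ℕ) → Fin k → ℕ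
countΠ∷ {k} n a c = length (filter (InΠ? a ∘ (c ∷_)) (allVecs k n))

module _ {k} (n : ℕ) (a : Fin k → ℕ) where

  countΠ-suc : countΠ (suc n) a ≡ ∑ (countΠ∷ n a)
  countΠ-suc = length-filter-allVecs-suc (InΠ? a)

  countΠ∷-pos : ∀ {c} → 1 ≤ a c → countΠ∷ n a c ≡ countΠ n (decrementAt a c)
  countΠ∷-pos {c} 1≤ac =
    cong length (filter-≐ (InΠ? a ∘ (c ∷_)) (InΠ? (decrementAt a c))
                          ((λ {v} → InΠ-∷⁺ a {v = v}) , (λ {v} → InΠ-∷⁻ a {v = v} 1≤ac))
                          (allVecs k n))

  countΠ∷-zero : ∀ {c} → a c ≡ 0 → countΠ∷ n a c ≡ 0
  countΠ∷-zero {c} ac≡0 =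
    cong length (filter-none (InΠ? a ∘ (c ∷_)) (universal (λ v → ¬InΠ-∷ a {v = v} ac≡0) (allVecs k n)))

countΠ-zero : ∀ {k} (a : Fin k → ℕ) → ∑ a ≡ 0 → countΠ 0 a ≡ 1
countΠ-zero a ∑a≡0 = cong length (filter-accept (InΠ? a) (λ i → sym (∑≡0⇒≡0 a ∑a≡0 i)))

∏-factorial-zero : ∀ {k} (a : Fin k → ℕ) → ∑ a ≡ 0 → ∏ (λ j → a j !) ≡ 1
∏-factorial-zero {k} a ∑a≡0 = trans (Productℕ.sum-cong-≗ (cong _! ∘ ∑≡0⇒≡0 a ∑a≡0)) (Productℕ.sum-replicate-zero k)

mutual
  countΠ-multinomial : ∀ {k} n (a : Fin k → ℕ) → ∑ a ≡ n → countΠ n a * ∏ (λ j → a j !) ≡ n !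
  countΠ-multinomial zero a ∑a≡0 = cong₂ _*_ (countΠ-zero a ∑a≡0) (∏-factorial-zero a ∑a≡0)
  countΠ-multinomial (suc n) a ∑a≡1+n = begin
    countΠ (suc n) a * A!               ≡⟨ cong (_* A!) (countΠ-suc n a) ⟩
    ∑ (countΠ∷ n a) * A!                ≡⟨ Sumℕ.*-distribʳ-sum A! (countΠ∷ n a) ⟩
    ∑ (λ c → countΠ∷ n a c * A!)        ≡⟨ Sumℕ.sum-cong-≗ (λ c → countΠ∷-multinomial n a c ∑a≡1+n) ⟩
    ∑ (λ c → a c * n !)                 ≡⟨ Sumℕ.*-distribʳ-sum (n !) a ⟨
    ∑ a * n !                           ≡⟨ cong (_* n !) ∑a≡1+n ⟩
    suc n * n !                         ∎
    where
    open ≡-Reasoning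
    A! = ∏ (λ j → a j !)

  countΠ∷-multinomial : ∀ {k} n (a : Fin k → ℕ) c → ∑ a ≡ suc n → countΠ∷ n a c * ∏ (λ j → a j !) ≡ a c * n !
  countΠ∷-multinomial n a c ∑a≡1+n with a c ≟ 0
  ... | yes ac≡0 = trans (cong (_* _) (countΠ∷-zero n a ac≡0)) (cong (_* n !) (sym ac≡0))
  ... | no ac≢0 = begin
    countΠ∷ n a c * ∏ (λ j → a j !)         ≡⟨ cong₂ _*_ (countΠ∷-pos n a 1≤ac) (∏-factorial-decrementAt a 1≤ac) ⟩
    countΠ n a′ * (a c * ∏ (λ j → a′ j !))  ≡⟨ x∙yz≈y∙xz (countΠ n a′) (a c) _ ⟩
    a c * (countΠ n a′ * ∏ (λ j → a′ j !))  ≡⟨ cong (a c *_) (countΠ-multinomial n a′ ∑a′≡n) ⟩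
    a c * n !                               ∎
    where
    open ≡-Reasoning
    1≤ac = n≢0⇒n>0 ac≢0
    a′ = decrementAt a c
    ∑a′≡n = suc-injective (trans (sym (∑-decrementAt a 1≤ac)) ∑a≡1+n)

mutual
  denom≡∏ : ∀ {k} (a : Fin k → ℕ) i → denom a i ≡ ∏ (λ j → decrementAt a i j !)
  denom≡∏ {k} a i = trans (cong product (map-cong (denom-factor a i) (allFin k)))
                          (foldr-map-allFin _*_ 1 (λ j → decrementAt a i j !))

  -- The left-hand side is the j-th factor of denom a i, a where-bound function of Defs that
  -- cannot be named here; it is solved from the use above.
  denom-factor : ∀ {k} (a : Fin k → ℕ) (i j : Fin k) → _ ≡ decrementAt a i j !
  denom-factor a i j with j ≟ᶠ i
  ... | yes _ = refl
  ... | no _ = refl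

sum-others : ∀ {k} (f : Fin k → ℕ) j → sum (map f (filter (λ i → ¬? (i ≟ᶠ j)) (allFin k))) + f j ≡ ∑ f
sum-others {k} f j = begin
  sum (map f (filter (λ i → ¬? (i ≟ᶠ j)) (allFin k))) + f j  ≡⟨ cong (_+ f j) (sum-map-filter (λ i → ¬? (i ≟ᶠ j)) f (allFin k)) ⟩
  sum (map g (allFin k)) + f j                             ≡⟨ cong (_+ f j) (foldr-map-allFin _+_ 0 g) ⟩
  ∑ g + f j                                                ≡⟨ +-comm (∑ g) (f j) ⟩
  f j + ∑ g                                                ≡⟨ sum-update +-0-commutativeMonoid {f = f} {g = g} j (f j) g-other g-self ⟨
  ∑ f                                                      ∎
  where
  open ≡-Reasoning
  g : Fin k → ℕ
  g i = if does (¬? (i ≟ᶠ j)) then f i else 0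
  g-other : ∀ i → i ≢ j → f i ≡ g i
  g-other i i≢j rewrite dec-false (i ≟ᶠ j) i≢j = refl
  g-self : f j ≡ f j + g j
  g-self rewrite dec-true (j ≟ᶠ j) refl = sym (+-identityʳ (f j))

module _ {k} (a : Fin k → ℕ) where

  s≡countΠ∷ : ∀ {n} c → total a ≡ suc n → s a c ≡ countΠ∷ n a c
  s≡countΠ∷ {n} c total≡1+n = begin
    s a c                                          ≡⟨ cong (λ t → length (filter (InΠ1? {t}) (allVecs k t))) total≡1+n ⟩
    length (filter InΠ1? (allVecs k (suc n)))      ≡⟨ length-filter-allVecs-suc InΠ1? ⟩
    ∑ headed-by                                    ≡⟨ ∑-concentrated headed-by c headed-by-other ⟩
    headed-by c                                    ≡⟨ cong length (filter-≐ _ (InΠ? a ∘ (c ∷_)) (proj₁ , (_, refl)) (allVecs k n)) ⟩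
    countΠ∷ n a c                                  ∎
    where
    open ≡-Reasoning
    InΠ1? : ∀ {t} (v : Vec (Fin k) t) → Dec (InΠ1 a c v)
    InΠ1? v = InΠ? a v ×-dec First? v c
    headed-by : Fin k → ℕ
    headed-by c′ = length (filter (InΠ1? ∘ (c′ ∷_)) (allVecs k n))
    headed-by-other : ∀ c′ → c′ ≢ c → headed-by c′ ≡ 0
    headed-by-other c′ c′≢c =
      cong length (filter-none (InΠ1? ∘ (c′ ∷_)) (universal (λ _ → c′≢c ∘ proj₂) (allVecs k n)))

  s-denom : ∀ {i} → 1 ≤ a i → s a i * denom a i ≡ (total a ∸ 1) !
  s-denom {i} 1≤ai = begin
    s a i * denom a i              ≡⟨ cong₂ _*_ (trans (s≡countΠ∷ i total≡1+n) (countΠ∷-pos n a 1≤ai)) (denom≡∏ a i) ⟩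
    countΠ n a′ * ∏ (λ j → a′ j !) ≡⟨ countΠ-multinomial n a′ refl ⟩
    n !                            ≡⟨ cong (λ t → (t ∸ 1) !) total≡1+n ⟨
    (total a ∸ 1) !                ∎
    where
    open ≡-Reasoning
    a′ = decrementAt a i
    n = ∑ a′
    total≡1+n : total a ≡ suc n
    total≡1+n = trans (total≡∑ a) (∑-decrementAt a 1≤ai)

module _ {p q : ℕ} .{{_ : NonZero p}} .{{_ : NonZero q}} {x y u v : ℕ}
         (xp≡uq : x * p ≡ u * q) (yp≡vq : y * p ≡ v * q) where

  ∝-mono-≤ : u ≤ v → x ≤ y
  ∝-mono-≤ u≤v = *-cancelʳ-≤ x y p (subst₂ _≤_ (sym xp≡uq) (sym yp≡vq) (*-monoˡ-≤ q u≤v))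

  ∝-mono-< : u < v → x < y
  ∝-mono-< u<v = *-cancelʳ-< p x y (subst₂ _<_ (sym xp≡uq) (sym yp≡vq) (*-monoˡ-< q u<v))

  ∝-cong : u ≡ v → x ≡ y
  ∝-cong u≡v = *-cancelʳ-≡ x y p (trans xp≡uq (trans (cong (_* q) u≡v) (sym yp≡vq)))

module Proportional {k} (a : Fin k → ℕ) {n} (total≡1+n : total a ≡ suc n) where

  A! : ℕ
  A! = ∏ (λ j → a j !)

  instance
    A!≢0 : NonZero A!
    A!≢0 = ∏-nonZero (λ j → a j !) (λ j → a j !≢0)
    n!≢0 : NonZero (n !)
    n!≢0 = n !≢0

  s∝a : ∀ j → s a j * A! ≡ a j * n !
  s∝a j = trans (cong (_* A!) (s≡countΠ∷ a j total≡1+n))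
                (countΠ∷-multinomial n a j (trans (sym (total≡∑ a)) total≡1+n))

  s+s∝2a : ∀ j → (s a j + s a j) * A! ≡ 2 * a j * n !
  s+s∝2a j = begin
    (s a j + s a j) * A!        ≡⟨ *-distribʳ-+ A! (s a j) (s a j) ⟩
    s a j * A! + s a j * A!     ≡⟨ cong₂ _+_ (s∝a j) (s∝a j) ⟩
    a j * n ! + a j * n !       ≡⟨ *-distribʳ-+ (n !) (a j) (a j) ⟨
    (a j + a j) * n !           ≡⟨ cong (λ t → (a j + t) * n !) (+-identityʳ (a j)) ⟨
    2 * a j * n !               ∎
    where open ≡-Reasoning

  others+s∝total : ∀ j → (sumOthers a j + s a j) * A! ≡ total a * n !
  others+s∝total j = begin
    (sumOthers a j + s a j) * A!   ≡⟨ cong (_* A!) (sum-others (s a) j) ⟩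
    ∑ (s a) * A!                   ≡⟨ Sumℕ.*-distribʳ-sum A! (s a) ⟩
    ∑ (λ i → s a i * A!)           ≡⟨ Sumℕ.sum-cong-≗ s∝a ⟩
    ∑ (λ i → a i * n !)            ≡⟨ Sumℕ.*-distribʳ-sum (n !) a ⟨
    ∑ a * n !                      ≡⟨ cong (_* n !) (total≡∑ a) ⟨
    total a * n !                  ∎
    where open ≡-Reasoning

InΠ⇒∃First : ∀ {k n} {a : Fin k → ℕ} {c} (v : Vec (Fin k) n) → 1 ≤ a c → InΠ a v → ∃ (First v)
InΠ⇒∃First {c = c} [] 1≤ac []∈Π = contradiction (sym ([]∈Π c)) (>⇒≢ 1≤ac)
InΠ⇒∃First (c ∷ _) _ _ = c , refl

Adj⇒First-distinct : ∀ {k n} (x y : Vec (Fin k) n) → Adj x y → ∀ c → First x c → ¬ First y c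
Adj⇒First-distinct (_ ∷ _) (_ ∷ _) (_ , tⱼ≢x₀ , y₀≡tⱼ , _) _ refl refl = tⱼ≢x₀ (sym y₀≡tⱼ)

lemma12 : (m : ℕ) → (a : Fin (suc (suc m)) → ℕ) → IsPartition a →
    -- k-partite with classes Π(a)^{1,1},...,Π(a)^{1,k}
    ((v : Vec (Fin (suc (suc m))) (total a)) → InΠ a v → ∃ λ c → First v c)
    × ((x y : Vec (Fin (suc (suc m))) (total a)) → InΠ a x → InΠ a y → Adj x y →
        (c : Fin (suc (suc m))) → First x c → ¬ First y c)
    -- s_i = (n-1)! / (a_1! ... (a_i - 1)! ... a_k!)
    × ((i : Fin (suc (suc m))) → s a i * denom a i ≡ (total a ∸ 1) !)
    -- s_1 ≥ s_2 ≥ ... ≥ s_k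
    × ((i j : Fin (suc (suc m))) → i ≤ᶠ j → s a j ≤ s a i)
    -- Δ(a) < 0, = 0, > 0
    × (total a < 2 * a zero → s a zero > sumOthers a zero)
    × (total a ≡ 2 * a zero → s a zero ≡ sumOthers a zero)
    × (total a > 2 * a zero → (j : Fin (suc (suc m))) → s a j < sumOthers a j)
lemma12 m a (a-antitone , a-pos) =
    (λ v → InΠ⇒∃First v (a-pos zero))
  , (λ x y _ _ → Adj⇒First-distinct x y)
  , (λ i → s-denom a (a-pos i))
  , (λ i j i≤j → ∝-mono-≤ (s∝a j) (s∝a i) (a-antitone i j i≤j))
  , (λ Δ<0 → +-cancelʳ-< _ _ _ (∝-mono-< (others+s∝total zero) (s+s∝2a zero) Δ<0))
  , (λ Δ≡0 → sym (+-cancelʳ-≡ _ _ _ (∝-cong (others+s∝total zero) (s+s∝2a zero) Δ≡0)))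
  , (λ Δ>0 j → +-cancelʳ-< _ _ _ (∝-mono-< (s+s∝2a j) (others+s∝total j) (2aⱼ<n Δ>0 j)))
  where
  open Proportional a (trans (total≡∑ a) (∑-decrementAt a (a-pos zero)))
  2aⱼ<n : total a > 2 * a zero → ∀ j → 2 * a j < total a
  2aⱼ<n Δ>0 j = ≤-<-trans (*-monoʳ-≤ 2 (a-antitone zero j z≤n)) Δ>0
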